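{- Every loopless graph $G=(V,E)$ (parallel edges allowed) with at least two vertices has a maximum cut $(X,Y)$ for which there exists a permutation $v_1,\dots,v_n$ of $V$ satisfying the following, where $X_i=X\cap\{v_1,\dots,v_i\}$ and $Y_i=Y\cap\{v_1,\dots,v_i\}$ for each $i\ge1$: (i) $v_1\in X$ and $v_2\in Y$; (ii) for every $i\ge3$, if $v_i\in X$ then $|v_i,X_{i-1}|\le|v_i,Y_{i-1}|$, and if $v_i\in Y$ then $|v_i,Y_{i-1}|\le |v_i,X_{i-1}|$; (iii) if $i\ge 3$ and $|v_i,Y_{i-1}|=|v_i,X_{i-1}|$, then either $\{v_{i-1},v_i\}\subseteq X$ or $\{v_{i-1},v_i\}\subseteq Y$.
   Context: For disjoint $A,B\subseteq V$, $|A,B|$ denotes the number of edges of $G$ (counted with multiplicity) between $A$ and $B$; $|a,B|$ means $|\{a\},B|$. A partition $(X,Y)$ of $V$ with $X\ne\emptyset\ne Y$ is a maximum cut if $|X,Y|$ is maximum among all such partitions. -}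

module Defs where

open import Data.Nat using (ℕ; zero; suc; _+_; _≤_; _<_; _<ᵇ_; _<?_)
open import Data.Fin using (Fin; toℕ)
open import Data.Bool using (Bool; true; false; if_then_else_)
open import Data.Product using (Σ; _×_; _,_)
open import Relation.Nullary using (yes; no)
open import Relation.Binary.PropositionalEquality using (_≡_)

∑ : {n : ℕ} → (Fin n → ℕ) → ℕ
∑ {zero}  f = 0
∑ {suc n} f = f Fin.zero + ∑ (λ k → f (Fin.suc k))

-- A loopless multigraph on vertex set Fin n:
-- mult u v = number of (parallel) edges between u and v.
record Multigraph (n : ℕ) : Set where
  field
    mult      : Fin n → Fin n → ℕ
    symmetric : ∀ u v → mult u v ≡ mult v u
    loopless  : ∀ v → mult v v ≡ 0
open Multigraph public

-- A partition (X,Y) of V is encoded by side : Fin n → Bool,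
-- X = {v | side v ≡ true}, Y = {v | side v ≡ false}.
Partition : ℕ → Set
Partition n = Fin n → Bool

Proper : {n : ℕ} → Partition n → Set
Proper {n} s = Σ (Fin n) (λ x → s x ≡ true) × Σ (Fin n) (λ y → s y ≡ false)

crossing : Bool → Bool → ℕ → ℕ
crossing true  false k = k
crossing false true  k = k
crossing _     _     _ = 0

-- contribution of the unordered pair {u,v}, counted once (only when toℕ u < toℕ v)
pairTerm : {n : ℕ} → Multigraph n → Partition n → Fin n → Fin n → ℕ
pairTerm G s u v with toℕ u <? toℕ v
... | yes _ = crossing (s u) (s v) (mult G u v)
... | no  _ = 0

cutSize : {n : ℕ} → Multigraph n → Partition n → ℕ
cutSize G s = ∑ (λ u → ∑ (λ v → pairTerm G s u v))

IsMaxCut : {n : ℕ} → Multigraph n → Partition n → Set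
IsMaxCut G s = Proper s × (∀ s′ → Proper s′ → cutSize G s′ ≤ cutSize G s)

sameSide : Bool → Bool → Bool
sameSide true  true  = true
sameSide false false = true
sameSide _     _     = false

-- |v, Z_p| where Z is the side b (true = X, false = Y) and Z_p = Z ∩ {σ 0, …, σ (p-1)}
-- (the first p vertices of the ordering σ; positions are 0-based, so the paper's
-- v_i is σ at position i-1 and the paper's Z_{i-1} is Z_p with p = i-1).
degPrefix : {n : ℕ} → Multigraph n → Partition n → (Fin n → Fin n) →
            Bool → ℕ → Fin n → ℕ
degPrefix G s σ b p v =
  ∑ (λ k → if toℕ k <ᵇ p
             then (if sameSide (s (σ k)) b then mult G v (σ k) else 0)
             else 0)

-- Start from any maximum cut and an ordering beginning with a vertex of X and one of Y,
-- and settle the positions one at a time. To settle position p, look for a later vertex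
-- whose degree into its own side among the first p vertices is at most its degree into the
-- other side, with equality only if it lies on the side of the vertex at position p - 1, and
-- swap it into position p. If there is none, every later vertex has own-side degree at least
-- its cross degree, so flipping all of them changes the cut by the sum of the differences;
-- maximality forces every difference to vanish, the flipped cut is again maximum, and the
-- vertex at position p, tied and formerly on the wrong side, now qualifies.

module Submission where

open import Defs
open import Algebra.Properties.CommutativeSemigroup using (interchange)
import Algebra.Properties.CommutativeMonoid.Sum as CommutativeMonoidSum
open import Data.Bool using (Bool; true; false; not; if_then_else_)
import Data.Bool.Properties as Bool
open import Data.Empty using (⊥-elim)
open import Data.Fin using (Fin; zero; suc; toℕ; fromℕ<; inject₁)
open import Data.Fin.Permutation using (transpose; _∘ₚ_; inverseˡ; inverseʳ)
import Data.Fin.Permutation.Components as Transposition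
open import Data.Fin.Properties using (any?; toℕ-injective; toℕ<n; toℕ-fromℕ<; toℕ-inject₁)
import Data.Fin.Properties as Fin
open import Data.Nat using (ℕ; zero; suc; _+_; _≤_; _<_; _<ᵇ_; z≤n; s≤s; s≤s⁻¹; z<s; _≤?_)
open import Data.Nat.Properties
open import Data.Product using (Σ; ∃₂; _×_; _,_; proj₁; proj₂)
open import Data.Sum using (_⊎_; inj₁; inj₂)
open import Data.Vec.Functional using (_∷_)
open import Function using (_∘_; mk⇔; Equivalence)
open import Function.Bundles using (_↔_; Inverse)
open import Relation.Binary.PropositionalEquality
  using (_≡_; _≢_; _≗_; refl; sym; trans; cong; cong₂; subst; subst₂; module ≡-Reasoning)
open import Relation.Nullary using (¬_; yes; no; Dec; does)
open import Relation.Nullary.Decidable using (dec-true; dec-false; does-⇔; _×-dec_; _→-dec_)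
open import Relation.Unary using (Decidable)
open import Relation.Binary.Definitions using (tri<; tri≈; tri>)

open ≡-Reasoning
module ℕ-Sum = CommutativeMonoidSum +-0-commutativeMonoid

∑-cong : ∀ {n} {f g : Fin n → ℕ} → f ≗ g → ∑ f ≡ ∑ g
∑-cong {zero}  _   = refl
∑-cong {suc n} f≗g = cong₂ _+_ (f≗g zero) (∑-cong (f≗g ∘ suc))

∑≡sum : ∀ {n} (f : Fin n → ℕ) → ∑ f ≡ ℕ-Sum.sum f
∑≡sum {zero}  f = refl
∑≡sum {suc n} f = cong (f zero +_) (∑≡sum (f ∘ suc))

∑-zero : ∀ n → ∑ {n} (λ _ → 0) ≡ 0
∑-zero zero    = refl
∑-zero (suc n) = ∑-zero n

∑-if-0 : ∀ {n} c (f : Fin n → ℕ) → ∑ (λ i → if c then 0 else f i) ≡ (if c then 0 else ∑ f)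
∑-if-0 {n} true  f = ∑-zero n
∑-if-0     false f = refl

∑-distrib-+ : ∀ {n} (f g : Fin n → ℕ) → ∑ (λ i → f i + g i) ≡ ∑ f + ∑ g
∑-distrib-+ f g = begin
  ∑ (λ i → f i + g i)          ≡⟨ ∑≡sum (λ i → f i + g i) ⟩
  ℕ-Sum.sum (λ i → f i + g i)  ≡⟨ ℕ-Sum.∑-distrib-+ f g ⟩
  ℕ-Sum.sum f + ℕ-Sum.sum g    ≡⟨ cong₂ _+_ (∑≡sum f) (∑≡sum g) ⟨
  ∑ f + ∑ g                    ∎

∑-permute : ∀ {n} (π : Fin n ↔ Fin n) (f : Fin n → ℕ) → ∑ f ≡ ∑ (f ∘ Inverse.to π)
∑-permute π f = begin
  ∑ f                              ≡⟨ ∑≡sum f ⟩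
  ℕ-Sum.sum f                      ≡⟨ ℕ-Sum.∑-permute f π ⟩
  ℕ-Sum.sum (f ∘ Inverse.to π)     ≡⟨ ∑≡sum (f ∘ Inverse.to π) ⟨
  ∑ (f ∘ Inverse.to π)             ∎

∑-mono-≤ : ∀ {n} {f g : Fin n → ℕ} → (∀ i → f i ≤ g i) → ∑ f ≤ ∑ g
∑-mono-≤ {zero}  _   = z≤n
∑-mono-≤ {suc n} f≤g = +-mono-≤ (f≤g zero) (∑-mono-≤ (f≤g ∘ suc))

+-≤-squeeze : ∀ {a b c d} → a ≤ c → b ≤ d → c + d ≤ a + b → a ≡ c × b ≡ d
+-≤-squeeze {a} {b} {c} {d} a≤c b≤d c+d≤a+b =
  ≤-antisym a≤c (+-cancelʳ-≤ d c a (≤-trans c+d≤a+b (+-monoʳ-≤ a b≤d))) ,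
  ≤-antisym b≤d (+-cancelˡ-≤ c d b (≤-trans c+d≤a+b (+-monoˡ-≤ b a≤c)))

∑-pointwise-≡ : ∀ {n} {f g : Fin n → ℕ} → (∀ i → f i ≤ g i) → ∑ g ≤ ∑ f → f ≗ g
∑-pointwise-≡ {suc n} f≤g ∑g≤∑f with +-≤-squeeze (f≤g zero) (∑-mono-≤ (f≤g ∘ suc)) ∑g≤∑f
... | head≡ , tail≡ = λ where
  zero    → head≡
  (suc i) → ∑-pointwise-≡ (f≤g ∘ suc) (≤-reflexive (sym tail≡)) i

∑₂ : ∀ {m n} → (Fin m → Fin n → ℕ) → ℕ
∑₂ f = ∑ λ i → ∑ (f i)

∑₂-cong : ∀ {m n} {f g : Fin m → Fin n → ℕ} → (∀ i j → f i j ≡ g i j) → ∑₂ f ≡ ∑₂ g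
∑₂-cong f≡g = ∑-cong λ i → ∑-cong (f≡g i)

∑₂-distrib-+ : ∀ {m n} (f g : Fin m → Fin n → ℕ) → ∑₂ (λ i j → f i j + g i j) ≡ ∑₂ f + ∑₂ g
∑₂-distrib-+ f g = trans (∑-cong λ i → ∑-distrib-+ (f i) (g i)) (∑-distrib-+ (∑ ∘ f) (∑ ∘ g))

∑₂-transpose : ∀ {n} (f : Fin n → Fin n → ℕ) → ∑₂ (λ i j → f j i) ≡ ∑₂ f
∑₂-transpose f = begin
  ∑₂ (λ i j → f j i)                              ≡⟨ as-sum (λ i j → f j i) ⟩
  ℕ-Sum.sum (λ i → ℕ-Sum.sum λ j → f j i)         ≡⟨ ℕ-Sum.∑-comm (λ i j → f j i) ⟩
  ℕ-Sum.sum (λ j → ℕ-Sum.sum λ i → f j i)         ≡⟨ as-sum f ⟨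
  ∑₂ f                                            ∎
  where
  as-sum : ∀ {n} (g : Fin n → Fin n → ℕ) → ∑₂ g ≡ ℕ-Sum.sum (λ i → ℕ-Sum.sum (g i))
  as-sum g = trans (∑≡sum (∑ ∘ g)) (ℕ-Sum.sum-cong-≗ (∑≡sum ∘ g))

m+m≡n+n⇒m≡n : ∀ {m n} → m + m ≡ n + n → m ≡ n
m+m≡n+n⇒m≡n {m} {n} eq with <-cmp m n
... | tri< m<n _ _ = ⊥-elim (<-irrefl eq (+-mono-< m<n m<n))
... | tri≈ _ m≡n _ = m≡n
... | tri> _ _ n<m = ⊥-elim (<-irrefl (sym eq) (+-mono-< n<m n<m))

argmax : ∀ n (f : (Fin n → Bool) → ℕ) → (∀ {s t} → s ≗ t → f s ≡ f t) →
         Σ (Fin n → Bool) λ s → ∀ t → f t ≤ f s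
argmax zero    f f-cong = (λ ()) , λ t → ≤-reflexive (f-cong λ ())
argmax (suc n) f f-cong = pick (best true) (best false)
  where
  Best : Bool → Set
  Best b = Σ (Fin n → Bool) λ s → ∀ t → f (b ∷ t) ≤ f (b ∷ s)

  best : ∀ b → Best b
  best b = argmax n (f ∘ (b ∷_)) λ s≗t → f-cong λ { zero → refl ; (suc i) → s≗t i }

  dominates : ∀ {s} → (∀ b t → f (b ∷ t) ≤ f s) → ∀ t → f t ≤ f s
  dominates bound t =
    ≤-trans (≤-reflexive (f-cong λ { zero → refl ; (suc i) → refl })) (bound (t zero) (t ∘ suc))

  pick : Best true → Best false → Σ (Fin (suc n) → Bool) λ s → ∀ t → f t ≤ f s
  pick (sᵗ , maxᵗ) (sᶠ , maxᶠ) with f (true ∷ sᵗ) ≤? f (false ∷ sᶠ)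
  ... | yes ᵗ≤ᶠ = false ∷ sᶠ , dominates λ { true t → ≤-trans (maxᵗ t) ᵗ≤ᶠ ; false t → maxᶠ t }
  ... | no  ᵗ≰ᶠ = true ∷ sᵗ  , dominates λ { true t → maxᵗ t ; false t → ≤-trans (maxᶠ t) (<⇒≤ (≰⇒> ᵗ≰ᶠ)) }

Proper? : ∀ {n} → Decidable (Proper {n})
Proper? s = any? (λ x → s x Bool.≟ true) ×-dec any? (λ y → s y Bool.≟ false)

Proper-resp-≗ : ∀ {n} {s t : Partition n} → s ≗ t → Proper s → Proper t
Proper-resp-≗ s≗t ((x , sx) , (y , sy)) = (x , trans (sym (s≗t x)) sx) , (y , trans (sym (s≗t y)) sy)

crossing-not : ∀ a b x → crossing (not a) (not b) x ≡ crossing a b x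
crossing-not true  true  x = refl
crossing-not true  false x = refl
crossing-not false true  x = refl
crossing-not false false x = refl

crossing-comm : ∀ a b x → crossing a b x ≡ crossing b a x
crossing-comm true  true  x = refl
crossing-comm true  false x = refl
crossing-comm false true  x = refl
crossing-comm false false x = refl

crossing-zero : ∀ a b → crossing a b 0 ≡ 0
crossing-zero true  true  = refl
crossing-zero true  false = refl
crossing-zero false true  = refl
crossing-zero false false = refl

<ᵇ-true : ∀ {m n} → m < n → (m <ᵇ n) ≡ true
<ᵇ-true m<n = Equivalence.to Bool.T-≡ (<⇒<ᵇ m<n)

<ᵇ-false : ∀ {m n} → n ≤ m → (m <ᵇ n) ≡ false
<ᵇ-false {m} {n} n≤m with m <ᵇ n in m<ᵇn
... | false = refl
... | true  = ⊥-elim (<⇒≱ (<ᵇ⇒< m n (Equivalence.from Bool.T-≡ m<ᵇn)) n≤m)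

<ᵇ-false⁻¹ : ∀ m n → (m <ᵇ n) ≡ false → n ≤ m
<ᵇ-false⁻¹ m n m≮ᵇn = ≮⇒≥ λ m<n → Bool.not-¬ (<ᵇ-true m<n) m≮ᵇn

transpose-matchˡ : ∀ {n} (i j : Fin n) → Transposition.transpose i j i ≡ j
transpose-matchˡ i j rewrite dec-true (i Fin.≟ i) refl = refl

transpose-fixes : ∀ {n} {i j k : Fin n} → k ≢ i → k ≢ j → Transposition.transpose i j k ≡ k
transpose-fixes {i = i} {j} {k} k≢i k≢j rewrite dec-false (k Fin.≟ i) k≢i | dec-false (k Fin.≟ j) k≢j = refl

permutation-starting : ∀ {n} {x y : Fin (suc (suc n))} → x ≢ y →
  Σ (Fin (suc (suc n)) ↔ Fin (suc (suc n))) λ π → Inverse.to π zero ≡ x × Inverse.to π (suc zero) ≡ y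
permutation-starting {x = x} {y} x≢y = transpose (suc zero) j ∘ₚ τ , to-zero , to-one
  where
  τ = transpose zero x
  j = Inverse.from τ y

  j≢zero : j ≢ zero
  j≢zero j≡zero = x≢y (begin
    x                   ≡⟨ transpose-matchˡ zero x ⟨
    Inverse.to τ zero   ≡⟨ cong (Inverse.to τ) j≡zero ⟨
    Inverse.to τ j      ≡⟨ inverseʳ τ ⟩
    y                   ∎)

  to-zero = trans (cong (Inverse.to τ) (transpose-fixes {i = suc zero} (λ ()) (j≢zero ∘ sym))) (transpose-matchˡ zero x)
  to-one  = trans (cong (Inverse.to τ) (transpose-matchˡ (suc zero) j)) (inverseʳ τ)

flipOutside : ∀ {n} → (Fin n → Bool) → Partition n → Partition n
flipOutside K s v = if K v then s v else not (s v)

∑Outside : ∀ {n} → (Fin n → Bool) → (Fin n → ℕ) → ℕ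
∑Outside K f = ∑ λ u → if K u then 0 else f u

edgeInto : Bool → Bool → Bool → ℕ → ℕ
edgeInto kw c b x = if kw then (if sameSide c b then x else 0) else 0

crossing-flip : ∀ ku kw a b x →
  crossing (if ku then a else not a) (if kw then b else not b) x
    + ((if ku then 0 else edgeInto kw b (not a) x) + (if kw then 0 else edgeInto ku a (not b) x))
  ≡ crossing a b x
    + ((if ku then 0 else edgeInto kw b a x) + (if kw then 0 else edgeInto ku a b x))
crossing-flip true  true  a     b     x = refl
crossing-flip false false a     b     x = cong (_+ 0) (crossing-not a b x)
crossing-flip true  false true  true  x = +-identityʳ x
crossing-flip true  false true  false x = sym (+-identityʳ x)
crossing-flip true  false false true  x = sym (+-identityʳ x)
crossing-flip true  false false false x = +-identityʳ x
crossing-flip false true  true  true  x = refl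
crossing-flip false true  true  false x = refl
crossing-flip false true  false true  x = refl
crossing-flip false true  false false x = refl

module _ {n : ℕ} (G : Multigraph n) where

  pairTerm-cong : ∀ {s t : Partition n} → s ≗ t → ∀ u v → pairTerm G s u v ≡ pairTerm G t u v
  pairTerm-cong s≗t u v with toℕ u <? toℕ v
  ... | yes _ = cong₂ (λ a b → crossing a b (mult G u v)) (s≗t u) (s≗t v)
  ... | no  _ = refl

  maxCut-exists : (s₀ : Partition n) → Proper s₀ → Σ (Partition n) (IsMaxCut G)
  maxCut-exists s₀ proper₀ = from-argmax (argmax n score score-cong)
    where
    score : Partition n → ℕ
    score s = if does (Proper? s) then suc (cutSize G s) else 0

    score-cong : ∀ {s t} → s ≗ t → score s ≡ score t
    score-cong {s} {t} s≗t =
      cong₂ (λ b c → if b then suc c else 0)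
            (does-⇔ (mk⇔ (Proper-resp-≗ s≗t) (Proper-resp-≗ (sym ∘ s≗t))) (Proper? s) (Proper? t))
            (∑₂-cong (pairTerm-cong s≗t))

    score-proper : ∀ {s} → Proper s → score s ≡ suc (cutSize G s)
    score-proper {s} proper rewrite dec-true (Proper? s) proper = refl

    score-improper : ∀ {s} → ¬ Proper s → score s ≡ 0
    score-improper {s} improper rewrite dec-false (Proper? s) improper = refl

    from-argmax : (Σ (Partition n) λ s → ∀ t → score t ≤ score s) → Σ (Partition n) (IsMaxCut G)
    from-argmax (s , max) with Proper? s
    ... | yes proper  = s , proper , λ t proper-t →
      s≤s⁻¹ (subst₂ _≤_ (score-proper proper-t) (score-proper proper) (max t))
    ... | no improper = ⊥-elim (n≮0 (subst₂ _≤_ (score-proper proper₀) (score-improper improper) (max s₀)))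

  crossSum : Partition n → ℕ
  crossSum s = ∑₂ λ u w → crossing (s u) (s w) (mult G u w)

  crossing≡pairTerms : ∀ s u w → crossing (s u) (s w) (mult G u w) ≡ pairTerm G s u w + pairTerm G s w u
  crossing≡pairTerms s u w with toℕ u <? toℕ w | toℕ w <? toℕ u
  ... | yes u<w | yes w<u = ⊥-elim (<-asym u<w w<u)
  ... | yes _   | no  _   = sym (+-identityʳ _)
  ... | no  _   | yes _   = trans (crossing-comm (s u) (s w) _) (cong (crossing (s w) (s u)) (symmetric G u w))
  ... | no  u≮w | no  w≮u = begin
    crossing (s u) (s w) (mult G u w)  ≡⟨ cong (λ x → crossing (s u) (s w) (mult G u x)) (sym u≡w) ⟩
    crossing (s u) (s w) (mult G u u)  ≡⟨ cong (crossing (s u) (s w)) (loopless G u) ⟩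
    crossing (s u) (s w) 0             ≡⟨ crossing-zero (s u) (s w) ⟩
    0                                  ∎
    where u≡w = toℕ-injective (≤-antisym (≮⇒≥ w≮u) (≮⇒≥ u≮w))

  crossSum≡cutSize+cutSize : ∀ s → crossSum s ≡ cutSize G s + cutSize G s
  crossSum≡cutSize+cutSize s = begin
    crossSum s                                        ≡⟨ ∑₂-cong (crossing≡pairTerms s) ⟩
    ∑₂ (λ u w → pairTerm G s u w + pairTerm G s w u)  ≡⟨ ∑₂-distrib-+ (pairTerm G s) _ ⟩
    cutSize G s + ∑₂ (λ u w → pairTerm G s w u)       ≡⟨ cong (cutSize G s +_) (∑₂-transpose (pairTerm G s)) ⟩
    cutSize G s + cutSize G s                         ∎

  degInto : Partition n → (Fin n → Bool) → Bool → Fin n → ℕ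
  degInto s K b v = ∑ λ w → edgeInto (K w) (s w) b (mult G v w)

  -- Flipping the vertices outside K uncuts their edges into the opposite side of K and
  -- cuts those into their own side; every other edge keeps its status. Both sides are
  -- doubled because crossSum counts each edge twice.
  crossSum-flipOutside : ∀ K s →
    crossSum (flipOutside K s)
      + (∑Outside K (λ u → degInto s K (not (s u)) u) + ∑Outside K (λ u → degInto s K (not (s u)) u))
    ≡ crossSum s
      + (∑Outside K (λ u → degInto s K (s u) u) + ∑Outside K (λ u → degInto s K (s u) u))
  crossSum-flipOutside K s = begin
    crossSum s′ + (A + A)                        ≡⟨ cong (crossSum s′ +_) (halves (not ∘ s)) ⟨
    crossSum s′ + (∑₂ T + ∑₂ (λ u w → T w u))    ≡⟨ split (crossingIn s′) T ⟨
    ∑₂ (λ u w → crossingIn s′ u w + (T u w + T w u))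
                                                 ≡⟨ ∑₂-cong pointwise ⟩
    ∑₂ (λ u w → crossingIn s u w + (S u w + S w u))
                                                 ≡⟨ split (crossingIn s) S ⟩
    crossSum s + (∑₂ S + ∑₂ (λ u w → S w u))     ≡⟨ cong (crossSum s +_) (halves s) ⟩
    crossSum s + (B + B)                         ∎
    where
    s′ = flipOutside K s
    A = ∑Outside K λ u → degInto s K (not (s u)) u
    B = ∑Outside K λ u → degInto s K (s u) u

    crossingIn : Partition n → Fin n → Fin n → ℕ
    crossingIn t u w = crossing (t u) (t w) (mult G u w)

    edgesOut : (Fin n → Bool) → Fin n → Fin n → ℕ
    edgesOut side u w = if K u then 0 else edgeInto (K w) (s w) (side u) (mult G u w)
    T = edgesOut (not ∘ s)
    S = edgesOut s

    split : ∀ (f g : Fin n → Fin n → ℕ) →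
            ∑₂ (λ u w → f u w + (g u w + g w u)) ≡ ∑₂ f + (∑₂ g + ∑₂ (λ u w → g w u))
    split f g = trans (∑₂-distrib-+ f _) (cong (∑₂ f +_) (∑₂-distrib-+ g (λ u w → g w u)))

    halves : ∀ side → ∑₂ (edgesOut side) + ∑₂ (λ u w → edgesOut side w u)
                      ≡ ∑Outside K (λ u → degInto s K (side u) u) + ∑Outside K (λ u → degInto s K (side u) u)
    halves side = cong₂ _+_ rows (trans (∑₂-transpose (edgesOut side)) rows)
      where rows = ∑-cong λ u → ∑-if-0 (K u) (λ w → edgeInto (K w) (s w) (side u) (mult G u w))

    pointwise : ∀ u w → crossingIn s′ u w + (T u w + T w u) ≡ crossingIn s u w + (S u w + S w u)
    pointwise u w rewrite symmetric G w u = crossing-flip (K u) (K w) (s u) (s w) (mult G u w)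

  cutSize-flipOutside : ∀ K s →
    cutSize G (flipOutside K s) + ∑Outside K (λ u → degInto s K (not (s u)) u)
      ≡ cutSize G s + ∑Outside K (λ u → degInto s K (s u) u)
  cutSize-flipOutside K s = m+m≡n+n⇒m≡n (begin
    (c′ + A) + (c′ + A)   ≡⟨ interchange +-commutativeSemigroup c′ A c′ A ⟩
    (c′ + c′) + (A + A)   ≡⟨ cong (_+ (A + A)) (crossSum≡cutSize+cutSize (flipOutside K s)) ⟨
    crossSum (flipOutside K s) + (A + A)
                          ≡⟨ crossSum-flipOutside K s ⟩
    crossSum s + (B + B)  ≡⟨ cong (_+ (B + B)) (crossSum≡cutSize+cutSize s) ⟩
    (c + c) + (B + B)     ≡⟨ interchange +-commutativeSemigroup c c B B ⟩
    (c + B) + (c + B)     ∎)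
    where
    c′ = cutSize G (flipOutside K s)
    c  = cutSize G s
    A  = ∑Outside K λ u → degInto s K (not (s u)) u
    B  = ∑Outside K λ u → degInto s K (s u) u

  flipOutside-maxCut : ∀ K s → IsMaxCut G s → Proper (flipOutside K s) →
    (∀ u → K u ≡ false → degInto s K (not (s u)) u ≤ degInto s K (s u) u) →
    IsMaxCut G (flipOutside K s) × (∀ u → K u ≡ false → degInto s K (not (s u)) u ≡ degInto s K (s u) u)
  flipOutside-maxCut K s (_ , max) proper′ cross≤own = (proper′ , max′) , tied
    where
    outside-≤ : ∀ u → (if K u then 0 else degInto s K (not (s u)) u) ≤ (if K u then 0 else degInto s K (s u) u)
    outside-≤ u with K u in Ku
    ... | true  = z≤n
    ... | false = cross≤own u Ku

    squeezed = +-≤-squeeze (max (flipOutside K s) proper′) (∑-mono-≤ outside-≤)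
                           (≤-reflexive (sym (cutSize-flipOutside K s)))

    max′ : ∀ t → Proper t → cutSize G t ≤ cutSize G (flipOutside K s)
    max′ t proper-t = ≤-trans (max t proper-t) (≤-reflexive (sym (proj₁ squeezed)))

    tied : ∀ u → K u ≡ false → degInto s K (not (s u)) u ≡ degInto s K (s u) u
    tied u Ku = subst (λ k → (if k then 0 else degInto s K (not (s u)) u) ≡ (if k then 0 else degInto s K (s u) u))
                      Ku (∑-pointwise-≡ outside-≤ (≤-reflexive (sym (proj₂ squeezed))) u)

  before : (Fin n ↔ Fin n) → ℕ → Fin n → Bool
  before π k w = toℕ (Inverse.from π w) <ᵇ k

  degPrefix≡degInto : ∀ π s b k v → degPrefix G s (Inverse.to π) b k v ≡ degInto s (before π k) b v
  degPrefix≡degInto π s b k v = sym (trans (∑-permute π _) (∑-cong λ i →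
    cong (λ j → edgeInto (toℕ j <ᵇ k) (s (Inverse.to π i)) b (mult G v (Inverse.to π i))) (inverseˡ π)))

  record Agree (k : ℕ) (s : Partition n) (σ : Fin n → Fin n) (s′ : Partition n) (σ′ : Fin n → Fin n) : Set where
    constructor agree
    field at : ∀ i → toℕ i < k → σ′ i ≡ σ i × s′ (σ i) ≡ s (σ i)

  Agree-≤ : ∀ {j k s σ s′ σ′} → j ≤ k → Agree k s σ s′ σ′ → Agree j s σ s′ σ′
  Agree-≤ j≤k (agree at) = agree λ i i<j → at i (≤-trans i<j j≤k)

  degPrefix-cong : ∀ {k s σ s′ σ′} → Agree k s σ s′ σ′ →
                   ∀ b v → degPrefix G s′ σ′ b k v ≡ degPrefix G s σ b k v
  degPrefix-cong {k} {s} {σ} {s′} {σ′} (agree at) b v = ∑-cong summand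
    where
    summand : ∀ i → edgeInto (toℕ i <ᵇ k) (s′ (σ′ i)) b (mult G v (σ′ i))
                  ≡ edgeInto (toℕ i <ᵇ k) (s (σ i)) b (mult G v (σ i))
    summand i with toℕ i <ᵇ k in i<ᵇk
    ... | false = refl
    ... | true  = cong₂ (λ c w → edgeInto true c b (mult G v w))
                        (trans (cong s′ σ′i≡σi) s′σi≡sσi) σ′i≡σi
      where
      σ′i≡σi   = proj₁ (at i (<ᵇ⇒< _ _ (Equivalence.from Bool.T-≡ i<ᵇk)))
      s′σi≡sσi = proj₂ (at i (<ᵇ⇒< _ _ (Equivalence.from Bool.T-≡ i<ᵇk)))

  ownDeg crossDeg : Partition n → (Fin n → Fin n) → ℕ → Fin n → ℕ
  ownDeg   s σ k v = degPrefix G s σ (s v) k v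
  crossDeg s σ k v = degPrefix G s σ (not (s v)) k v

  -- v may be placed at position k of σ when the vertex at position k - 1 is on side L.
  Fits : Partition n → (Fin n → Fin n) → ℕ → Bool → Fin n → Set
  Fits s σ k L v = ownDeg s σ k v ≤ crossDeg s σ k v × (ownDeg s σ k v ≡ crossDeg s σ k v → s v ≡ L)

  fits? : ∀ s σ k L → Decidable (Fits s σ k L)
  fits? s σ k L v =
    (ownDeg s σ k v ≤? crossDeg s σ k v) ×-dec ((ownDeg s σ k v ≟ crossDeg s σ k v) →-dec (s v Bool.≟ L))

  ¬Fits⇒crossDeg≤ownDeg : ∀ {s σ k L v} → ¬ Fits s σ k L v → crossDeg s σ k v ≤ ownDeg s σ k v
  ¬Fits⇒crossDeg≤ownDeg ¬fits =
    ≮⇒≥ λ own<cross → ¬fits (<⇒≤ own<cross , λ own≡cross → ⊥-elim (<⇒≢ own<cross own≡cross))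

  Fits-cong : ∀ {k s σ s′ σ′ L v} → Agree k s σ s′ σ′ → s′ v ≡ s v →
              Fits s σ k L v → Fits s′ σ′ k L v
  Fits-cong {k} {s} {σ} {s′} {σ′} {L} {v} agreement side (own≤cross , tie) =
    subst₂ _≤_ (sym own≡) (sym cross≡) own≤cross ,
    λ own′≡cross′ → trans side (tie (trans (sym own≡) (trans own′≡cross′ cross≡)))
    where
    own≡ : ownDeg s′ σ′ k v ≡ ownDeg s σ k v
    own≡ = trans (cong (λ c → degPrefix G s′ σ′ c k v) side) (degPrefix-cong agreement (s v) v)
    cross≡ : crossDeg s′ σ′ k v ≡ crossDeg s σ k v
    cross≡ = trans (cong (λ c → degPrefix G s′ σ′ (not c) k v) side) (degPrefix-cong agreement (not (s v)) v)

  -- Flipping v swaps its two degrees.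
  Fits-flipTied : ∀ {k s σ s′ L v} → Agree k s σ s′ σ → s′ v ≡ not (s v) →
    ownDeg s σ k v ≡ crossDeg s σ k v → s v ≢ L → Fits s′ σ k L v
  Fits-flipTied {k} {s} {σ} {s′} {L} {v} agreement side own≡cross wrong-side =
    ≤-reflexive own′≡cross′ , λ _ → trans side (sym (Bool.¬-not (wrong-side ∘ sym)))
    where
    own′≡cross′ : ownDeg s′ σ k v ≡ crossDeg s′ σ k v
    own′≡cross′ = begin
      degPrefix G s′ σ (s′ v) k v               ≡⟨ cong (λ c → degPrefix G s′ σ c k v) side ⟩
      degPrefix G s′ σ (not (s v)) k v          ≡⟨ degPrefix-cong agreement (not (s v)) v ⟩
      crossDeg s σ k v                          ≡⟨ own≡cross ⟨
      ownDeg s σ k v                            ≡⟨ cong (λ c → degPrefix G s σ c k v) (Bool.not-involutive (s v)) ⟨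
      degPrefix G s σ (not (not (s v))) k v     ≡⟨ degPrefix-cong agreement (not (not (s v))) v ⟨
      degPrefix G s′ σ (not (not (s v))) k v    ≡⟨ cong (λ c → degPrefix G s′ σ (not c) k v) side ⟨
      degPrefix G s′ σ (not (s′ v)) k v         ∎

  Settled : Partition n → (Fin n → Fin n) → Fin n → Set
  Settled s σ p = ∀ q → suc (toℕ q) ≡ toℕ p → Fits s σ (toℕ p) (s (σ q)) (σ p)

predecessor : ∀ {n} (p : Fin (suc n)) → 0 < toℕ p → Σ (Fin (suc n)) λ q → suc (toℕ q) ≡ toℕ p
predecessor (suc q) _ = inject₁ q , cong suc (toℕ-inject₁ q)

≤-not⇒by-side : ∀ a (D : Bool → ℕ) → D a ≤ D (not a) →
  (a ≡ true → D true ≤ D false) × (a ≡ false → D false ≤ D true)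
≤-not⇒by-side true  D le = (λ _ → le) , λ ()
≤-not⇒by-side false D le = (λ ()) , λ _ → le

≡⇒≡-not : ∀ a (D : Bool → ℕ) → D false ≡ D true → D a ≡ D (not a)
≡⇒≡-not true  D eq = sym eq
≡⇒≡-not false D eq = eq

≡⇒both : ∀ {a b} → a ≡ b → (a ≡ true × b ≡ true) ⊎ (a ≡ false × b ≡ false)
≡⇒both {true}  refl = inj₁ (refl , refl)
≡⇒both {false} refl = inj₂ (refl , refl)

module _ {m : ℕ} (G : Multigraph (suc (suc m))) where

  private
    N : ℕ
    N = suc (suc m)

  record Admissible (k : ℕ) (s : Partition N) (π : Fin N ↔ Fin N) : Set where
    field
      maxCut  : IsMaxCut G s
      first   : s (Inverse.to π zero) ≡ true
      second  : s (Inverse.to π (suc zero)) ≡ false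
      settled : ∀ p → 2 ≤ toℕ p → toℕ p < k → Settled G s (Inverse.to π) p
  open Admissible

  Admissible-cong : ∀ {k s π s′ π′} → 2 ≤ k → IsMaxCut G s′ →
    Agree G k s (Inverse.to π) s′ (Inverse.to π′) → Admissible k s π → Admissible k s′ π′
  Admissible-cong {k} {s} {π} {s′} {π′} 2≤k maxCut′ agreement@(agree at) adm = record
    { maxCut  = maxCut′
    ; first   = trans (side-kept zero (≤-trans (s≤s z≤n) 2≤k)) (first adm)
    ; second  = trans (side-kept (suc zero) 2≤k) (second adm)
    ; settled = λ p 2≤p p<k q q+1≡p →
        subst₂ (Fits G s′ σ′ (toℕ p)) (sym (side-kept q (<-trans (≤-reflexive q+1≡p) p<k)))
                                      (sym (proj₁ (at p p<k)))
               (Fits-cong G (Agree-≤ G (<⇒≤ p<k) agreement) (proj₂ (at p p<k)) (settled adm p 2≤p p<k q q+1≡p))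
    }
    where
    σ  = Inverse.to π
    σ′ = Inverse.to π′
    side-kept : ∀ i → toℕ i < k → s′ (σ′ i) ≡ s (σ i)
    side-kept i i<k = trans (cong s′ (proj₁ (at i i<k))) (proj₂ (at i i<k))

  Admissible-extend : ∀ {s π} p → Admissible (toℕ p) s π → Settled G s (Inverse.to π) p →
                      Admissible (suc (toℕ p)) s π
  Admissible-extend {s} {π} p adm settledₚ = record
    { maxCut = maxCut adm ; first = first adm ; second = second adm ; settled = settled′ }
    where
    settled′ : ∀ p′ → 2 ≤ toℕ p′ → toℕ p′ < suc (toℕ p) → Settled G s (Inverse.to π) p′
    settled′ p′ 2≤p′ p′≤p with m<1+n⇒m<n∨m≡n p′≤p
    ... | inj₁ p′<p = settled adm p′ 2≤p′ p′<p
    ... | inj₂ p′≡p with toℕ-injective p′≡p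
    ...   | refl = settledₚ

  Admissible-swapIn : ∀ {s π} p q → 2 ≤ toℕ p → suc (toℕ q) ≡ toℕ p → Admissible (toℕ p) s π →
    ∀ v → toℕ p ≤ toℕ (Inverse.from π v) → Fits G s (Inverse.to π) (toℕ p) (s (Inverse.to π q)) v →
    Admissible (suc (toℕ p)) s (transpose p (Inverse.from π v) ∘ₚ π)
  Admissible-swapIn {s} {π} p q 2≤p q+1≡p adm v p≤j fits =
    Admissible-extend p (Admissible-cong 2≤p (maxCut adm) agreement adm) settledₚ
    where
    σ  = Inverse.to π
    j  = Inverse.from π v
    σ′ = Inverse.to (transpose p j ∘ₚ π)

    unmoved : ∀ i → toℕ i < toℕ p → σ′ i ≡ σ i
    unmoved i i<p = cong σ (transpose-fixes (λ i≡p → <-irrefl (cong toℕ i≡p) i<p)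
                                            (λ i≡j → <⇒≱ i<p (subst (toℕ p ≤_) (cong toℕ (sym i≡j)) p≤j)))

    agreement : Agree G (toℕ p) s σ s σ′
    agreement = agree λ i i<p → unmoved i i<p , refl

    settledₚ : Settled G s σ′ p
    settledₚ q′ q′+1≡p = subst₂ (Fits G s σ′ (toℕ p)) last-side v-at-p (Fits-cong G agreement refl fits)
      where
      last-side : s (σ q) ≡ s (σ′ q′)
      last-side = cong s (trans (cong σ (toℕ-injective (suc-injective (trans q+1≡p (sym q′+1≡p)))))
                                (sym (unmoved q′ (≤-reflexive q′+1≡p))))
      v-at-p : v ≡ σ′ p
      v-at-p = sym (trans (cong σ (transpose-matchˡ p j)) (inverseʳ π))

  Admissible-flipSuffix : ∀ {s π} p q → 2 ≤ toℕ p → suc (toℕ q) ≡ toℕ p → Admissible (toℕ p) s π →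
    (∀ v → toℕ p ≤ toℕ (Inverse.from π v) → ¬ Fits G s (Inverse.to π) (toℕ p) (s (Inverse.to π q)) v) →
    Σ (Partition N) λ s′ → Admissible (toℕ p) s′ π ×
                           Fits G s′ (Inverse.to π) (toℕ p) (s′ (Inverse.to π q)) (Inverse.to π p)
  Admissible-flipSuffix {s} {π} p q 2≤p q+1≡p adm misfit =
    s′ , Admissible-cong 2≤p (proj₁ flipped) agreement adm , fits′
    where
    σ  = Inverse.to π
    k  = toℕ p
    K  = before G π k
    s′ = flipOutside K s

    K-σ : ∀ i → K (σ i) ≡ (toℕ i <ᵇ k)
    K-σ i = cong (λ j → toℕ j <ᵇ k) (inverseˡ π)

    prefix : ∀ i → toℕ i < k → s′ (σ i) ≡ s (σ i)
    prefix i i<k = cong (λ c → if c then s (σ i) else not (s (σ i))) (trans (K-σ i) (<ᵇ-true i<k))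

    agreement : Agree G k s σ s′ σ
    agreement = agree λ i i<k → refl , prefix i i<k

    proper′ : Proper s′
    proper′ = (σ zero , trans (prefix zero (≤-trans (s≤s z≤n) 2≤p)) (first adm)) ,
              (σ (suc zero) , trans (prefix (suc zero) 2≤p) (second adm))

    cross≤own : ∀ u → K u ≡ false → degInto G s K (not (s u)) u ≤ degInto G s K (s u) u
    cross≤own u Ku = subst₂ _≤_ (degPrefix≡degInto G π s (not (s u)) k u) (degPrefix≡degInto G π s (s u) k u)
                                (¬Fits⇒crossDeg≤ownDeg G {s} {σ} {k} {s (σ q)} {u} (misfit u (<ᵇ-false⁻¹ _ k Ku)))

    flipped = flipOutside-maxCut G K s (maxCut adm) proper′ cross≤own

    Kₚ : K (σ p) ≡ false
    Kₚ = trans (K-σ p) (<ᵇ-false {k} {k} ≤-refl)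

    tied : ownDeg G s σ k (σ p) ≡ crossDeg G s σ k (σ p)
    tied = sym (subst₂ _≡_ (sym (degPrefix≡degInto G π s (not (s (σ p))) k (σ p)))
                           (sym (degPrefix≡degInto G π s (s (σ p)) k (σ p)))
                           (proj₂ flipped (σ p) Kₚ))

    wrong-side : s (σ p) ≢ s (σ q)
    wrong-side same-side = misfit (σ p) (<ᵇ-false⁻¹ _ k Kₚ) (≤-reflexive tied , λ _ → same-side)

    fits′ : Fits G s′ σ k (s′ (σ q)) (σ p)
    fits′ = subst (λ L → Fits G s′ σ k L (σ p)) (sym (prefix q (≤-reflexive q+1≡p)))
                  (Fits-flipTied G agreement (cong (λ c → if c then s (σ p) else not (s (σ p))) Kₚ) tied wrong-side)

  Admissible-step : ∀ {s π} p q → 2 ≤ toℕ p → suc (toℕ q) ≡ toℕ p → Admissible (toℕ p) s π →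
                    ∃₂ (Admissible (suc (toℕ p)))
  Admissible-step {s} {π} p q 2≤p q+1≡p adm =
    decide (any? λ v → (toℕ p ≤? toℕ (Inverse.from π v)) ×-dec fits? G s σ (toℕ p) L v)
    where
    σ = Inverse.to π
    L = s (σ q)

    decide : Dec (Σ (Fin N) λ v → toℕ p ≤ toℕ (Inverse.from π v) × Fits G s σ (toℕ p) L v) →
             ∃₂ (Admissible (suc (toℕ p)))
    decide (yes (v , p≤v , fits)) = _ , _ , Admissible-swapIn p q 2≤p q+1≡p adm v p≤v fits
    decide (no none) =
      let s′ , adm′ , fits′ = Admissible-flipSuffix p q 2≤p q+1≡p adm (λ v p≤v fits → none (v , p≤v , fits))
      in  _ , _ , Admissible-swapIn p q 2≤p q+1≡p adm′ (σ p) (≤-reflexive (cong toℕ (sym (inverseˡ π)))) fits′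

  Admissible-start : ∃₂ (Admissible 2)
  Admissible-start = from-maxCut (maxCut-exists G (true ∷ λ _ → false) ((zero , refl) , (suc zero , refl)))
    where
    from-maxCut : Σ (Partition N) (IsMaxCut G) → ∃₂ (Admissible 2)
    from-maxCut (s , maxCut@(((x , sx) , (y , sy)) , _)) =
      let π , π₀≡x , π₁≡y = permutation-starting (λ x≡y → Bool.not-¬ sx (trans (cong s x≡y) sy))
      in  s , π , record
        { maxCut  = maxCut
        ; first   = trans (cong s π₀≡x) sx
        ; second  = trans (cong s π₁≡y) sy
        ; settled = λ p 2≤p p<2 → ⊥-elim (<⇒≱ p<2 2≤p)
        }

  admissible : ∀ d → d ≤ m → ∃₂ (Admissible (2 + d))
  admissible zero    _   = Admissible-start
  admissible (suc d) d<m =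
    let s , π , adm = admissible d (<⇒≤ d<m)
    in  subst (∃₂ ∘ Admissible ∘ suc) p≡
          (Admissible-step p q (≤-trans (m≤m+n 2 d) (≤-reflexive (sym p≡))) (trans (cong suc q≡) (sym p≡))
                   (subst (λ k → Admissible k s π) (sym p≡) adm))
    where
    p = fromℕ< (s≤s (s≤s d<m))
    q = fromℕ< (s≤s (s≤s (<⇒≤ d<m)))
    p≡ = toℕ-fromℕ< (s≤s (s≤s d<m))
    q≡ = toℕ-fromℕ< (s≤s (s≤s (<⇒≤ d<m)))

  module _ {s π} (adm : Admissible N s π) where
    private
      σ = Inverse.to π
      fits : ∀ p q → 2 ≤ toℕ p → suc (toℕ q) ≡ toℕ p → Fits G s σ (toℕ p) (s (σ q)) (σ p)
      fits p q 2≤p = settled adm p 2≤p (toℕ<n p) q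

      degreesAt : Fin N → Bool → ℕ
      degreesAt p b = degPrefix G s σ b (toℕ p) (σ p)

    Admissible⇒by-side : ∀ p → 2 ≤ toℕ p →
      (s (σ p) ≡ true → degPrefix G s σ true (toℕ p) (σ p) ≤ degPrefix G s σ false (toℕ p) (σ p)) ×
      (s (σ p) ≡ false → degPrefix G s σ false (toℕ p) (σ p) ≤ degPrefix G s σ true (toℕ p) (σ p))
    Admissible⇒by-side p 2≤p =
      let q , q+1≡p = predecessor p (<-trans z<s 2≤p)
      in  ≤-not⇒by-side (s (σ p)) (degreesAt p) (proj₁ (fits p q 2≤p q+1≡p))

    Admissible⇒same-side-on-tie : ∀ p q → 2 ≤ toℕ p → suc (toℕ q) ≡ toℕ p →
      degPrefix G s σ false (toℕ p) (σ p) ≡ degPrefix G s σ true (toℕ p) (σ p) →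
      (s (σ q) ≡ true × s (σ p) ≡ true) ⊎ (s (σ q) ≡ false × s (σ p) ≡ false)
    Admissible⇒same-side-on-tie p q 2≤p q+1≡p tie =
      ≡⇒both (sym (proj₂ (fits p q 2≤p q+1≡p) (≡⇒≡-not (s (σ p)) (degreesAt p) tie)))

theorem12 : (m : ℕ) → (G : Multigraph (suc (suc m))) →
  Σ (Partition (suc (suc m))) λ s → IsMaxCut G s ×
  Σ (Fin (suc (suc m)) ↔ Fin (suc (suc m))) λ π →
    let σ = Inverse.to π in
    (s (σ zero) ≡ true × s (σ (suc zero)) ≡ false) ×
    (∀ (p : Fin (suc (suc m))) → 2 ≤ toℕ p →
      (s (σ p) ≡ true → degPrefix G s σ true (toℕ p) (σ p) ≤ degPrefix G s σ false (toℕ p) (σ p)) ×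
      (s (σ p) ≡ false → degPrefix G s σ false (toℕ p) (σ p) ≤ degPrefix G s σ true (toℕ p) (σ p))) ×
    (∀ (p q : Fin (suc (suc m))) → 2 ≤ toℕ p → suc (toℕ q) ≡ toℕ p →
      degPrefix G s σ false (toℕ p) (σ p) ≡ degPrefix G s σ true (toℕ p) (σ p) →
      (s (σ q) ≡ true × s (σ p) ≡ true) ⊎ (s (σ q) ≡ false × s (σ p) ≡ false))
theorem12 m G =
  let s , π , adm = admissible G m ≤-refl
  in  s , Admissible.maxCut adm , π , (Admissible.first adm , Admissible.second adm) ,
      Admissible⇒by-side G adm , Admissible⇒same-side-on-tie G adm
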